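{- Over an alphabet with as many characters as needed, the self-referencing LZSS factorization size $\mathit{z}_{SSsr}$ satisfies: (substitutions) $\liminf_{n\to\infty}\mathsf{MS}_{\mathrm{sub}}(\mathit{z}_{SSsr},n)\ge 3$, $\mathsf{AS}_{\mathrm{sub}}(\mathit{z}_{SSsr},n)\ge 2\mathit{z}_{SSsr}-\Theta(\sqrt{\mathit{z}_{SSsr}})$ and $\mathsf{AS}_{\mathrm{sub}}(\mathit{z}_{SSsr},n)=\Omega(\sqrt n)$; (insertions) $\liminf_{n\to\infty}\mathsf{MS}_{\mathrm{ins}}(\mathit{z}_{SSsr},n)\ge 2$, $\mathsf{AS}_{\mathrm{ins}}(\mathit{z}_{SSsr},n)\ge \mathit{z}_{SSsr}-\Theta(\sqrt{\mathit{z}_{SSsr}})$ and $\mathsf{AS}_{\mathrm{ins}}(\mathit{z}_{SSsr},n)=\Omega(\sqrt n)$; (deletions) $\liminf_{n\to\infty}\mathsf{MS}_{\mathrm{del}}(\mathit{z}_{SSsr},n)\ge 3$, $\mathsf{AS}_{\mathrm{del}}(\mathit{z}_{SSsr},n)\ge 2\mathit{z}_{SSsr}-\Theta(\sqrt{\mathit{z}_{SSsr}})$ and $\mathsf{AS}_{\mathrm{del}}(\mathit{z}_{SSsr},n)=\Omega(\sqrt n)$. Here $\mathsf{AS}_{\mathrm{x}}\ge a\,\mathit{z}_{SSsr}-\Theta(\sqrt{\mathit{z}_{SSsr}})$ means: there are a constant $c$ and strings $T$ with $\mathit{z}_{SSsr}(T)$ arbitrarily large, each with a string $T'$ obtained by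 one edit of type $\mathrm{x}$, such that $\mathit{z}_{SSsr}(T')-\mathit{z}_{SSsr}(T)\ge a\,\mathit{z}_{SSsr}(T)-c\sqrt{\mathit{z}_{SSsr}(T)}$.
   Context: The self-referencing LZSS factorization of a string $T$ is $T=f_1\cdots f_z$ defined greedily left to right: with $s=|f_1\cdots f_{i-1}|$, if $T[s+1]$ does not occur in $T[1..s]$ then $f_i=T[s+1]$; otherwise $f_i$ is the longest prefix of $T[s+1..|T|]$ that has an occurrence in $T$ starting at some position in $[1..s]$ (overlaps allowed). $\mathit{z}_{SSsr}(T)=z$. $\mathsf{ed}$ is edit distance; $\mathsf{MS}_{\mathrm{sub}}(C,n)=\sup\{C(T')/C(T):T\in\Sigma^n,T'\in\Sigma^n,\mathsf{ed}(T,T')=1\}$, with $T'\in\Sigma^{n+1}$ (ins) or $\Sigma^{n-1}$ (del); $\mathsf{AS}$ analogously with differences. -}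

module Defs where

open import Data.Nat using (ℕ; zero; suc; _+_; _*_; _∸_; _⊔_; _⊓_; _≤_; _<_; _≡ᵇ_; _<ᵇ_)
open import Data.Bool using (Bool; true; false; if_then_else_)
open import Data.List using (List; []; _∷_; length; drop; map; foldr; upTo)
open import Data.Product using (_×_; Σ; ∃; ∃-syntax; _,_)
open import Relation.Binary.PropositionalEquality using (_≡_)

-- Strings over the alphabet ℕ (an alphabet with as many characters as needed).
-- Positions are 0-indexed below.
Str : Set
Str = List ℕ

lcp : Str → Str → ℕ
lcp (x ∷ xs) (y ∷ ys) = if x ≡ᵇ y then suc (lcp xs ys) else 0
lcp _ _ = 0

-- It is 0 iff T[s] does not occur in T[0..s-1].
maxRef : Str → ℕ → ℕ
maxRef T s = foldr _⊔_ 0 (map (λ j → lcp (drop j T) (drop s T)) (upTo s))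

-- Greedy self-referencing LZSS: the phrase starting at s has length
-- 1 (fresh character) if maxRef T s = 0, and maxRef T s otherwise,
-- i.e. length 1 ⊔ maxRef T s.  Counts phrases from position s; the fuel
-- argument (≥ |T| suffices, since each phrase has length ≥ 1) ensures termination.
zAux : ℕ → Str → ℕ → ℕ
zAux zero    T s = 0
zAux (suc f) T s =
  if s <ᵇ length T then suc (zAux f T (s + (1 ⊔ maxRef T s))) else 0

zSSsr : Str → ℕ
zSSsr T = zAux (length T) T 0

ed : Str → Str → ℕ
ed [] ys = length ys
ed xs@(_ ∷ _) [] = length xs
ed (x ∷ xs) (y ∷ ys) =
  ((ed xs ys + (if x ≡ᵇ y then 0 else 1)) ⊓ suc (ed xs (y ∷ ys))) ⊓ suc (ed (x ∷ xs) ys)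

data EditKind : Set where
  sub ins del : EditKind

LenOK : EditKind → ℕ → ℕ → Set
LenOK sub n m = m ≡ n
LenOK ins n m = m ≡ suc n
LenOK del n m = suc m ≡ n

OneEdit : EditKind → Str → Str → Set
OneEdit k T T' = ed T T' ≡ 1 × LenOK k (length T) (length T')

-- liminf_{n→∞} MS_k(C,n) ≥ a, unfolded: for every ε = 1/(e+1) there is N such
-- that for all n ≥ N, MS_k(C,n) > a - ε, i.e. some T ∈ Σ^n and one-edit T'
-- satisfy C(T')/C(T) > a - 1/(e+1), i.e. (e+1)·C(T') + C(T) > a·(e+1)·C(T).
LiminfMSAtLeast : (Str → ℕ) → EditKind → ℕ → Set
LiminfMSAtLeast C k a =
  ∀ (e : ℕ) → ∃[ N ] ∀ (n : ℕ) → N ≤ n →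
    ∃[ T ] ∃[ T' ] (length T ≡ n × OneEdit k T T' ×
      a * suc e * C T < suc e * C T' + C T)

-- AS_k(C) ≥ a·C - Θ(√C): there is a constant c and strings T with C(T)
-- arbitrarily large, each with a one-edit T' such that
-- C(T') - C(T) ≥ a·C(T) - c·√C(T), i.e. c·√C(T) ≥ (a+1)·C(T) - C(T'),
-- written without square roots as ((a+1)·C(T) ∸ C(T'))² ≤ c²·C(T).
ASAtLeastLinear : (Str → ℕ) → EditKind → ℕ → Set
ASAtLeastLinear C k a =
  ∃[ c ] ∀ (m : ℕ) → ∃[ T ] ∃[ T' ] (m ≤ C T × OneEdit k T T' ×
    (suc a * C T ∸ C T') * (suc a * C T ∸ C T') ≤ c * c * C T)

-- AS_k(C,n) = Ω(√n): there are a constant 1/(d+1) > 0 and N such that for all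
-- n ≥ N some T ∈ Σ^n and one-edit T' satisfy C(T') - C(T) ≥ √n/(d+1),
-- i.e. n ≤ ((d+1)·(C(T') ∸ C(T)))².
ASOmegaSqrt : (Str → ℕ) → EditKind → Set
ASOmegaSqrt C k =
  ∃[ d ] ∃[ N ] ∀ (n : ℕ) → N ≤ n →
    ∃[ T ] ∃[ T' ] (length T ≡ n × OneEdit k T T' ×
      n ≤ (suc d * (C T' ∸ C T)) * (suc d * (C T' ∸ C T)))

-- Let k = b², low t = 2 + t mod b and high t = 2 + b + ⌊t / b⌋, and consider the text
--   (lows k · m · highs k) · block 0 ⋯ block (k − 1) · 0^p,   block j = lows j · u · highs (j + 1),
-- where lows j = low (j−1) ⋯ low 0 and highs j = high 0 ⋯ high (j−1).  When m = u every block occurs in the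
-- header lows k · m · highs k (lows k ends with lows j, highs k starts with highs (j + 1)), so greedy LZSS
-- needs O(b) phrases for the header plus one per block: z ≤ k + 3b + 4.  Conversely, greedy must start a
-- phrase inside every factor that has no earlier occurrence.  The junctions high j · low j between
-- consecutive blocks are such factors, so z ≥ k − 2 always; once m ≠ u, each factor lows j · (first letter
-- of u) is new too, and for u = 0 so is 0 · highs (j + 1).  One edit of m therefore raises z from about k to
-- 3k (substitution, deletion) or 2k (insertion); choosing b large in terms of ε, z or |T| gives the bounds.

module Submission where

open import Defs
open import Data.Nat using (ℕ; zero; suc; z<s; _+_; _*_; _∸_; _⊔_; _≤_; _<_; _≡ᵇ_; _<ᵇ_; z≤n; s≤s; s≤s⁻¹; _≤?_; _<?_; _≟_)
open import Data.Nat.Properties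
open import Data.Nat.DivMod using (_/_; _%_; m≡m%n+[m/n]*n; m%n<n; [m+n]%n≡m%n; +-distrib-/-∣ˡ; m*n/n≡m; m<n⇒m/n≡0)
open import Data.Nat.Divisibility using (n∣m*n)
open import Data.Bool using (true; false; if_then_else_) renaming (T to IsTrue)
open import Data.Unit using (tt)
open import Data.List using (List; []; _∷_; _++_; length; drop; map; foldr; upTo; replicate; applyUpTo; applyDownFrom)
open import Data.List.Properties using (length-++; drop-drop; ++-assoc; length-applyUpTo; length-applyDownFrom; applyUpTo-∷ʳ; length-replicate; ++-identityʳ; ++-cancelˡ; length-++-sucʳ)
open import Data.List.Membership.Propositional using (_∈_)
open import Data.List.Membership.Propositional.Properties using (∈-upTo⁺; ∈-upTo⁻)
open import Data.List.Relation.Unary.Any using (here; there)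
open import Data.List.Relation.Unary.All as All using (All; []; _∷_)
open import Data.List.Relation.Unary.All.Properties using (++⁺; applyUpTo⁺₂; applyDownFrom⁺₂)
open import Data.Product using (_×_; Σ; ∃; ∃-syntax; _,_; proj₁; proj₂)
open import Data.Sum using (_⊎_; inj₁; inj₂; map₁)
open import Data.Empty using (⊥-elim)
open import Relation.Nullary using (¬_; yes; no)
open import Relation.Binary.PropositionalEquality
open import Relation.Binary.Definitions using (tri<; tri≈; tri>)
open import Data.Nat.Tactic.RingSolver using (solve-∀)

≡ᵇ-refl : ∀ x → (x ≡ᵇ x) ≡ true
≡ᵇ-refl zero    = refl
≡ᵇ-refl (suc x) = ≡ᵇ-refl x

infix 4 _≼_
_≼_ : Str → Str → Set
W ≼ S = Σ Str λ r → S ≡ W ++ r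

≼-++ʳ : ∀ (W R : Str) → W ≼ W ++ R
≼-++ʳ W R = R , refl

≼-trans : ∀ {A B C : Str} → A ≼ B → B ≼ C → A ≼ C
≼-trans {A} (r , refl) (r' , refl) = r ++ r' , ++-assoc A r r'

++⁺-≼ : ∀ (A : Str) {W S} → W ≼ S → A ++ W ≼ A ++ S
++⁺-≼ A {W} (r , refl) = r , sym (++-assoc A W r)

drop⁺-≼ : ∀ t {W S} → W ≼ S → drop t W ≼ drop t S
drop⁺-≼ zero    p                   = p
drop⁺-≼ (suc t) {[]}    {S} _       = drop (suc t) S , refl
drop⁺-≼ (suc t) {w ∷ W} (r , refl) = drop⁺-≼ t (r , refl)

≼-head : ∀ {a c W S} → a ∷ W ≼ c ∷ S → a ≡ c
≼-head (_ , refl) = refl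

mismatch⇒⋠ : ∀ t {W S a c W' S'} → drop t W ≡ a ∷ W' → drop t S ≡ c ∷ S' → a ≢ c → ¬ W ≼ S
mismatch⇒⋠ t eW eS a≢c p with drop⁺-≼ t p
... | p' rewrite eW | eS = a≢c (≼-head p')

≼⇒≤lcp : ∀ W {A B} → W ≼ A → W ≼ B → length W ≤ lcp A B
≼⇒≤lcp []      _          _          = z≤n
≼⇒≤lcp (w ∷ W) (r₁ , refl) (r₂ , refl) rewrite ≡ᵇ-refl w = s≤s (≼⇒≤lcp W (r₁ , refl) (r₂ , refl))

≤lcp⇒≼ : ∀ W A {B} → length W ≤ lcp A B → W ≼ B → W ≼ A
≤lcp⇒≼ []      A       _  _          = A , refl
≤lcp⇒≼ (w ∷ W) (a ∷ A) le (r , refl) with a ≡ᵇ w in eq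
... | true  = let (r' , e) = ≤lcp⇒≼ W A (s≤s⁻¹ le) (r , refl)
              in r' , cong₂ _∷_ (≡ᵇ⇒≡ a w (subst IsTrue (sym eq) tt)) e

lcp-drop : ∀ d A B → lcp A B ∸ d ≤ lcp (drop d A) (drop d B)
lcp-drop zero    A       B       = ≤-refl
lcp-drop (suc d) []      B       = z≤n
lcp-drop (suc d) (a ∷ A) []      = z≤n
lcp-drop (suc d) (a ∷ A) (b ∷ B) with a ≡ᵇ b
... | true  = lcp-drop d A B
... | false = z≤n

drop-++ˡ : ∀ d (A B : Str) → d ≤ length A → drop d (A ++ B) ≡ drop d A ++ B
drop-++ˡ zero    A       B _         = refl
drop-++ˡ (suc d) (x ∷ A) B (s≤s le) = drop-++ˡ d A B le

drop-length-++ : ∀ (A B : Str) → drop (length A) (A ++ B) ≡ B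
drop-length-++ []      B = refl
drop-length-++ (x ∷ A) B = drop-length-++ A B

drop-applyDownFrom-++ : ∀ (f : ℕ → ℕ) d n S → drop d (applyDownFrom f (d + n) ++ S) ≡ applyDownFrom f n ++ S
drop-applyDownFrom-++ f zero    n S = refl
drop-applyDownFrom-++ f (suc d) n S = drop-applyDownFrom-++ f d n S

drop-applyDownFrom-++-self : ∀ (f : ℕ → ℕ) d S → drop d (applyDownFrom f d ++ S) ≡ S
drop-applyDownFrom-++-self f zero    S = refl
drop-applyDownFrom-++-self f (suc d) S = drop-applyDownFrom-++-self f d S

drop-applyUpTo-++-self : ∀ (f : ℕ → ℕ) d S → drop d (applyUpTo f d ++ S) ≡ S
drop-applyUpTo-++-self f zero    S = refl
drop-applyUpTo-++-self f (suc d) S = drop-applyUpTo-++-self (λ t → f (suc t)) d S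

drop-applyUpTo : ∀ (f : ℕ → ℕ) d n → drop d (applyUpTo f (d + n)) ≡ applyUpTo (λ t → f (d + t)) n
drop-applyUpTo f zero    n = refl
drop-applyUpTo f (suc d) n = drop-applyUpTo (λ t → f (suc t)) d n

applyUpTo-++ : ∀ (f : ℕ → ℕ) m n → applyUpTo f (m + n) ≡ applyUpTo f m ++ applyUpTo (λ t → f (m + t)) n
applyUpTo-++ f zero    n = refl
applyUpTo-++ f (suc m) n = cong (f 0 ∷_) (applyUpTo-++ (λ t → f (suc t)) m n)

applyUpTo-const : ∀ (f : ℕ → ℕ) c n → (∀ t → t < n → f t ≡ c) → applyUpTo f n ≡ replicate n c
applyUpTo-const f c zero    _ = refl
applyUpTo-const f c (suc n) e = cong₂ _∷_ (e 0 z<s) (applyUpTo-const _ c n (λ t t<n → e (suc t) (s≤s t<n)))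

applyDownFrom-periodic : ∀ (f : ℕ → ℕ) p → (∀ t → f (t + p) ≡ f t) → ∀ n → applyDownFrom f n ≼ applyDownFrom f (n + p)
applyDownFrom-periodic f p periodic zero    = applyDownFrom f p , refl
applyDownFrom-periodic f p periodic (suc n) =
  let (r , e) = applyDownFrom-periodic f p periodic n in r , cong₂ _∷_ (periodic n) e

replicate-≼-∷ : ∀ (c : ℕ) n → replicate n c ≼ c ∷ replicate n c
replicate-≼-∷ c zero    = _ , refl
replicate-≼-∷ c (suc n) = let (r , e) = replicate-≼-∷ c n in r , cong (c ∷_) e

drop-suc : ∀ t (X : Str) {x S} → drop t X ≡ x ∷ S → drop (suc t) X ≡ S
drop-suc zero    (y ∷ X) refl = refl
drop-suc (suc t) (y ∷ X) e    = drop-suc t X e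

<-offset : ∀ {t j} → t < j → ∃ λ d → j ≡ t + suc d
<-offset {zero}  {suc j} _        = j , refl
<-offset {suc t} {suc j} (s≤s lt) = let (d , e) = <-offset lt in d , cong suc e

lcp≤maxRef : ∀ T s j → j < s → lcp (drop j T) (drop s T) ≤ maxRef T s
lcp≤maxRef T s j j<s = go (upTo s) (∈-upTo⁺ j<s)
  where
  go : ∀ l → j ∈ l → lcp (drop j T) (drop s T) ≤ foldr _⊔_ 0 (map (λ i → lcp (drop i T) (drop s T)) l)
  go (x ∷ l) (here refl) = m≤m⊔n _ _
  go (x ∷ l) (there j∈l) = ≤-trans (go l j∈l) (m≤n⊔m _ _)

maxRef≤ : ∀ T s b → (∀ j → j < s → lcp (drop j T) (drop s T) ≤ b) → maxRef T s ≤ b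
maxRef≤ T s b bound = go (upTo s) (λ j j∈ → bound j (∈-upTo⁻ j∈))
  where
  go : ∀ l → (∀ j → j ∈ l → lcp (drop j T) (drop s T) ≤ b) →
       foldr _⊔_ 0 (map (λ i → lcp (drop i T) (drop s T)) l) ≤ b
  go []      _     = z≤n
  go (x ∷ l) bound = ⊔-lub (bound x (here refl)) (go l (λ j j∈l → bound j (there j∈l)))

nextPhrase : Str → ℕ → ℕ
nextPhrase T s = s + (1 ⊔ maxRef T s)

<nextPhrase : ∀ T s → s < nextPhrase T s
<nextPhrase T s = ≤-trans (≤-reflexive (+-comm 1 s)) (+-monoʳ-≤ s (m≤m⊔n 1 (maxRef T s)))

zAux-< : ∀ f T s → s < length T → zAux (suc f) T s ≡ suc (zAux f T (nextPhrase T s))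
zAux-< f T s s<T with s <ᵇ length T in eq
... | true  = refl
... | false = ⊥-elim (subst IsTrue eq (<⇒<ᵇ s<T))

zAux-≥ : ∀ f T s → length T ≤ s → zAux f T s ≡ 0
zAux-≥ zero    T s _ = refl
zAux-≥ (suc f) T s T≤s with s <ᵇ length T in eq
... | true  = ⊥-elim (<⇒≱ (<ᵇ⇒< s (length T) (subst IsTrue (sym eq) tt)) T≤s)
... | false = refl

data Phrase (X : Str) (t : ℕ) : ℕ → Set where
  fresh : Phrase X t (suc t)
  copy  : ∀ j W → j < t → W ≼ drop j X → W ≼ drop t X → Phrase X t (t + length W)

infixr 5 _◅_ _◅◅_
data Parse (X : Str) : ℕ → ℕ → ℕ → Set where
  ε   : ∀ {t} → Parse X t t 0
  _◅_ : ∀ {t t' u k} → Phrase X t t' → Parse X t' u k → Parse X t u (suc k)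

_◅◅_ : ∀ {X t u v k l} → Parse X t u k → Parse X u v l → Parse X t v (k + l)
ε        ◅◅ q = q
(f ◅ p) ◅◅ q = f ◅ (p ◅◅ q)

Phrase⇒≤nextPhrase : ∀ {X t t'} s → Phrase X t t' → t ≤ s → s < t' → t' ≤ nextPhrase X s
Phrase⇒≤nextPhrase {X} s fresh t≤s _ = ≤-trans (s≤s t≤s) (<nextPhrase X s)
Phrase⇒≤nextPhrase {X} {t} s (copy j W j<t W≼j W≼t) t≤s s<t' = begin
  t + length W           ≡⟨ cong (t +_) (sym (m+[n∸m]≡n (<⇒≤ d<W))) ⟩
  t + (d + (length W ∸ d)) ≡⟨ sym (+-assoc t d _) ⟩
  t + d + (length W ∸ d) ≡⟨ cong (_+ (length W ∸ d)) t+d≡s ⟩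
  s + (length W ∸ d)     ≤⟨ +-monoʳ-≤ s (≤-trans rest≤maxRef (m≤n⊔m 1 _)) ⟩
  nextPhrase X s         ∎
  where
  open ≤-Reasoning
  d = s ∸ t
  t+d≡s : t + d ≡ s
  t+d≡s = m+[n∸m]≡n t≤s
  d<W : d < length W
  d<W = +-cancelˡ-< t d (length W) (subst (_< t + length W) (sym t+d≡s) s<t')
  shifted : length W ∸ d ≤ lcp (drop (j + d) X) (drop s X)
  shifted = subst₂ (λ A B → length W ∸ d ≤ lcp A B)
    (drop-drop j d X) (trans (drop-drop t d X) (cong (λ i → drop i X) t+d≡s))
    (≤-trans (∸-monoˡ-≤ d (≼⇒≤lcp W W≼j W≼t)) (lcp-drop d (drop j X) (drop t X)))
  rest≤maxRef : length W ∸ d ≤ maxRef X s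
  rest≤maxRef = ≤-trans shifted (lcp≤maxRef X s (j + d) (subst (j + d <_) t+d≡s (+-monoˡ-< d j<t)))

-- Greedy is optimal: by Phrase⇒≤nextPhrase, the greedy parse never falls behind any other parse.
zAux≤Parse : ∀ {X t u k} → Parse X t u k → length X ≤ u → ∀ f s → t ≤ s → zAux f X s ≤ k
zAux≤Parse {X} ε X≤u f s t≤s = ≤-reflexive (zAux-≥ f X s (≤-trans X≤u t≤s))
zAux≤Parse {X} (_◅_ {t' = t'} φ p) X≤u f s t≤s with t' ≤? s
... | yes t'≤s = ≤-trans (zAux≤Parse p X≤u f s t'≤s) (n≤1+n _)
... | no  t'≰s with s <? length X
...   | no  s≮X = ≤-trans (≤-reflexive (zAux-≥ f X s (≮⇒≥ s≮X))) z≤n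
zAux≤Parse {X} (_◅_ {t' = t'} φ p) X≤u zero    s t≤s | no t'≰s | yes s<X = z≤n
zAux≤Parse {X} (_◅_ {t' = t'} φ p) X≤u (suc f) s t≤s | no t'≰s | yes s<X
  rewrite zAux-< f X s s<X = s≤s (zAux≤Parse p X≤u f (nextPhrase X s) (Phrase⇒≤nextPhrase s φ t≤s (≰⇒> t'≰s)))

zSSsr≤Parse : ∀ {X k} → Parse X 0 (length X) k → zSSsr X ≤ k
zSSsr≤Parse {X} p = zAux≤Parse p ≤-refl (length X) 0 z≤n

Parse-cast : ∀ {X X' t t' u u' c c'} → X ≡ X' → t ≡ t' → u ≡ u' → c ≡ c' → Parse X t u c → Parse X' t' u' c'
Parse-cast refl refl refl refl p = p

fresh-parse : ∀ X t n → Parse X t (t + n) n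
fresh-parse X t zero    = Parse-cast refl refl (sym (+-identityʳ t)) refl ε
fresh-parse X t (suc n) = fresh ◅ Parse-cast refl refl (sym (+-suc t n)) refl (fresh-parse X (suc t) n)

-- A run c^(n+1) is one fresh letter followed by a self-overlapping copy of c^n.
run-parse : ∀ X t c n {R} → drop t X ≡ c ∷ replicate n c ++ R → Parse X t (t + suc n) 2
run-parse X t c n {R} run = fresh ◅ copy t (replicate n c) (n<1+n t) source target ◅
  Parse-cast refl refl (trans (cong (suc t +_) (length-replicate n)) (sym (+-suc t n))) refl ε
  where
  source : replicate n c ≼ drop t X
  source = subst (replicate n c ≼_) (sym run) (≼-trans (replicate-≼-∷ c n) (≼-++ʳ _ R))
  target : replicate n c ≼ drop (suc t) X
  target = subst (replicate n c ≼_) (sym (drop-suc t X run)) (≼-++ʳ _ R)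

Novel : Str → ℕ → ℕ → Set
Novel X q L = ∀ j → j < q → lcp (drop j X) (drop q X) < L

Novel-cast : ∀ {X X' q q' L L'} → X ≡ X' → q ≡ q' → L ≡ L' → Novel X q L → Novel X' q' L'
Novel-cast refl refl refl novel = novel

Barrier : Str → ℕ → ℕ → Set
Barrier X l h = ∀ s → s < l → nextPhrase X s ≤ h

-- A phrase starting at s ≤ q and reaching past q + L would copy the novel factor X[q .. q + L].
novel⇒nextPhrase≤ : ∀ X q L → Novel X q (suc L) → ∀ s → s ≤ q → s < q + L → nextPhrase X s ≤ q + L
novel⇒nextPhrase≤ X q L novel s s≤q s<q+L =
  ≤-trans (+-monoʳ-≤ s (⊔-lub (m<n⇒0<n∸m s<q+L) (maxRef≤ X s _ lcp≤)))
          (≤-reflexive (m+[n∸m]≡n (<⇒≤ s<q+L)))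
  where
  d = q ∸ s
  s+d≡q : s + d ≡ q
  s+d≡q = m+[n∸m]≡n s≤q
  q+L∸s≡d+L : q + L ∸ s ≡ d + L
  q+L∸s≡d+L = trans (cong (λ x → x + L ∸ s) (sym s+d≡q))
                    (trans (cong (_∸ s) (+-assoc s d L)) (m+n∸m≡n s (d + L)))
  lcp≤ : ∀ j → j < s → lcp (drop j X) (drop s X) ≤ q + L ∸ s
  lcp≤ j j<s with lcp (drop j X) (drop s X) ≤? q + L ∸ s
  ... | yes le = le
  ... | no  gt = ⊥-elim (<⇒≱ (novel (j + d) (subst (j + d <_) s+d≡q (+-monoˡ-< d j<s))) longer)
    where
    long : d + suc L ≤ lcp (drop j X) (drop s X)
    long = subst (_≤ lcp (drop j X) (drop s X)) (trans (cong suc q+L∸s≡d+L) (sym (+-suc d L))) (≰⇒> gt)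
    longer : suc L ≤ lcp (drop (j + d) X) (drop q X)
    longer = subst₂ (λ A B → suc L ≤ lcp A B)
      (drop-drop j d X) (trans (drop-drop s d X) (cong (λ i → drop i X) s+d≡q))
      (≤-trans (≤-reflexive (sym (m+n∸m≡n d (suc L)))) (≤-trans (∸-monoˡ-≤ d long) (lcp-drop d _ _)))

novel⇒barrier : ∀ X q L → Novel X q (suc (suc L)) → Barrier X (suc q) (q + suc L)
novel⇒barrier X q L novel s s<1+q =
  novel⇒nextPhrase≤ X q (suc L) novel s (s≤s⁻¹ s<1+q) (≤-<-trans (s≤s⁻¹ s<1+q) (m<m+n q z<s))

-- n disjoint windows [l, h] to the right of a; by Barrier the greedy parse starts a phrase in each.
data Barriers (X : Str) (a : ℕ) : ℕ → Set where
  []  : Barriers X a 0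
  _∷_ : ∀ {l h n} → Barrier X l h × h < length X × a < l → Barriers X h n → Barriers X a (suc n)

novel-window : ∀ {X a n} q L → Novel X q (suc (suc L)) → a ≤ q → q + suc L < length X →
               Barriers X (q + suc L) n → Barriers X a (suc n)
novel-window {X} q L novel a≤q h<X rest = (novel⇒barrier X q L novel , h<X , s≤s a≤q) ∷ rest

Barriers⇒≤zAux : ∀ {X a n} → Barriers X a n → ∀ f s → s ≤ a → length X ≤ f + s → n ≤ zAux f X s
Barriers⇒≤zAux [] f s _ _ = z≤n
Barriers⇒≤zAux {X} {n = suc n} (_∷_ {l} {h} (barrier , h<X , a<l) rest) f s s≤a fuel =
  enter f s (≤-<-trans s≤a a<l) fuel
  where
  inside : ∀ {s} → s < l → s < length X
  inside {s} s<l = <-trans (<-≤-trans (<nextPhrase X s) (barrier s s<l)) h<X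
  refuel : ∀ f s → length X ≤ suc f + s → length X ≤ f + nextPhrase X s
  refuel f s fuel = ≤-trans fuel (≤-trans (≤-reflexive (sym (+-suc f s))) (+-monoʳ-≤ f (<nextPhrase X s)))
  enter : ∀ f s → s < l → length X ≤ f + s → suc n ≤ zAux f X s
  enter zero    s s<l fuel = ⊥-elim (<⇒≱ (inside s<l) fuel)
  enter (suc f) s s<l fuel rewrite zAux-< f X s (inside s<l) with l ≤? nextPhrase X s
  ... | yes l≤s' = s≤s (Barriers⇒≤zAux rest f _ (barrier s s<l) (refuel f s fuel))
  ... | no  l≰s' = s≤s (≤-trans (n≤1+n _) (enter f _ (≰⇒> l≰s') (refuel f s fuel)))

Barriers⇒≤zSSsr : ∀ {X a n} → Barriers X a n → n ≤ zSSsr X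
Barriers⇒≤zSSsr {X} bs = Barriers⇒≤zAux bs (length X) 0 z≤n (≤-reflexive (sym (+-identityʳ _)))

Barriers-stack : ∀ {X} (pos : ℕ → ℕ) c a m →
  (∀ j n → a ≤ j → j < a + m → Barriers X (pos (suc j)) n → Barriers X (pos j) (c + n)) →
  Barriers X (pos a) (m * c)
Barriers-stack pos c a zero    step = []
Barriers-stack pos c a (suc m) step =
  step a (m * c) ≤-refl (m<m+n a z<s)
    (Barriers-stack pos c (suc a) m λ j n a<j j<a+m →
       step j n (<⇒≤ a<j) (subst (j <_) (sym (+-suc a m)) j<a+m))

Avoids : Str → Str → Str → Set
Avoids W U V = ∀ j → j < length U → ¬ W ≼ drop j U ++ V

Avoids-[] : ∀ W V → Avoids W [] V
Avoids-[] W V j ()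

Avoids-∷ : ∀ W x U V → ¬ W ≼ x ∷ U ++ V → Avoids W U V → Avoids W (x ∷ U) V
Avoids-∷ W x U V here-absent rest zero    _        = here-absent
Avoids-∷ W x U V here-absent rest (suc j) (s≤s j<U) = rest j j<U

Avoids-++ : ∀ W U₁ U₂ V → Avoids W U₁ (U₂ ++ V) → Avoids W U₂ V → Avoids W (U₁ ++ U₂) V
Avoids-++ W []       U₂ V _  av₂ = av₂
Avoids-++ W (x ∷ U₁) U₂ V av₁ av₂ =
  Avoids-∷ W x (U₁ ++ U₂) V (subst (λ S → ¬ W ≼ x ∷ S) (sym (++-assoc U₁ U₂ V)) (av₁ 0 z<s))
    (Avoids-++ W U₁ U₂ V (λ j j<U₁ → av₁ (suc j) (s≤s j<U₁)) av₂)

Avoids-head : ∀ w W U V → All (w ≢_) U → Avoids (w ∷ W) U V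
Avoids-head w W []      V []            = Avoids-[] _ V
Avoids-head w W (x ∷ U) V (w≢x ∷ w∉U) = Avoids-∷ _ x U V (λ p → w≢x (≼-head p)) (Avoids-head w W U V w∉U)

avoids⇒novel : ∀ U V W → W ≼ V → Avoids W U V → Novel (U ++ V) (length U) (length W)
avoids⇒novel U V W W≼V avoids j j<U with length W ≤? lcp (drop j (U ++ V)) (drop (length U) (U ++ V))
... | no  W≰lcp = ≰⇒> W≰lcp
... | yes W≤lcp = ⊥-elim (avoids j j<U (subst (W ≼_) (drop-++ˡ j U V (<⇒≤ j<U))
        (≤lcp⇒≼ W _ W≤lcp (subst (W ≼_) (sym (drop-length-++ U V)) W≼V))))

applyUpTo-avoids-pair : ∀ f n {w₁ w₂} z V → (∀ t → f t ≢ w₂) → f n ≢ w₁ ⊎ z ≢ w₂ →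
                        Avoids (w₁ ∷ w₂ ∷ []) (applyUpTo f (suc n)) (z ∷ V)
applyUpTo-avoids-pair f zero    z V f≢w₂ (inj₁ f≢w₁) =
  Avoids-∷ _ (f 0) [] _ (mismatch⇒⋠ 0 refl refl (λ e → f≢w₁ (sym e))) (Avoids-[] _ _)
applyUpTo-avoids-pair f zero    z V f≢w₂ (inj₂ z≢w₂) =
  Avoids-∷ _ (f 0) [] _ (mismatch⇒⋠ 1 refl refl (λ e → z≢w₂ (sym e))) (Avoids-[] _ _)
applyUpTo-avoids-pair f (suc n) z V f≢w₂ cond =
  Avoids-∷ _ (f 0) _ _ (mismatch⇒⋠ 1 refl refl (λ e → f≢w₂ 1 (sym e)))
    (applyUpTo-avoids-pair (λ t → f (suc t)) n z V (λ t → f≢w₂ (suc t)) cond)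

ed-refl : ∀ xs → ed xs xs ≡ 0
ed-refl []       = refl
ed-refl (x ∷ xs) rewrite ≡ᵇ-refl x | ed-refl xs = refl

ed-++ˡ : ∀ w a c → ed (w ++ a) (w ++ c) ≤ ed a c
ed-++ˡ []      a c = ≤-refl
ed-++ˡ (x ∷ w) a c rewrite ≡ᵇ-refl x =
  ≤-trans (m⊓n≤m _ _) (≤-trans (m⊓n≤m _ _) (≤-trans (≤-reflexive (+-identityʳ _)) (ed-++ˡ w a c)))

ed-substitute : ∀ x y R → ed (x ∷ R) (y ∷ R) ≤ 1
ed-substitute x y R =
  ≤-trans (m⊓n≤m _ _) (≤-trans (m⊓n≤m _ _) (≤-trans (+-monoˡ-≤ _ (≤-reflexive (ed-refl R))) (mismatch≤1 (x ≡ᵇ y))))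
  where
  mismatch≤1 : ∀ c → (if c then 0 else 1) ≤ 1
  mismatch≤1 true  = z≤n
  mismatch≤1 false = ≤-refl

ed-delete : ∀ x R → ed (x ∷ R) R ≤ 1
ed-delete x []      = ≤-refl
ed-delete x (y ∷ R) = ≤-trans (m⊓n≤m _ _) (≤-trans (m⊓n≤n _ _) (s≤s (≤-reflexive (ed-refl (y ∷ R)))))

ed-insert : ∀ x R → ed R (x ∷ R) ≤ 1
ed-insert x []      = ≤-refl
ed-insert x (y ∷ R) = ≤-trans (m⊓n≤n _ _) (s≤s (≤-reflexive (ed-refl (y ∷ R))))

ed≡0⇒≡ : ∀ a c → ed a c ≡ 0 → a ≡ c
ed≡0⇒≡ []      []      _ = refl
ed≡0⇒≡ (x ∷ a) (y ∷ c) e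
  with x ≡ᵇ y in eq | ed a c in eqa | ed a (y ∷ c) | ed (x ∷ a) c
... | true | zero | _ | _ = cong₂ _∷_ (≡ᵇ⇒≡ x y (subst IsTrue (sym eq) tt)) (ed≡0⇒≡ a c eqa)

≤1∧≢⇒ed≡1 : ∀ a c → ed a c ≤ 1 → a ≢ c → ed a c ≡ 1
≤1∧≢⇒ed≡1 a c ed≤1 a≢c with ed a c in eq
... | zero        = ⊥-elim (a≢c (ed≡0⇒≡ a c eq))
... | suc zero    = refl
... | suc (suc _) = ⊥-elim (<⇒≱ (s≤s (s≤s z≤n)) ed≤1)

module Construction (b' : ℕ) where

  b k : ℕ
  b = suc b'
  k = b * b

  low high : ℕ → ℕ
  low  t = 2 + t % b
  high t = 2 + b + t / b

  IsLow NotLow : ℕ → Set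
  IsLow  x = 2 ≤ x × x < 2 + b
  NotLow x = x < 2 ⊎ 2 + b ≤ x

  low≢notLow : ∀ {x y} → IsLow x → NotLow y → x ≢ y
  low≢notLow (2≤x , _) (inj₁ y<2)   refl = <⇒≱ y<2 2≤x
  low≢notLow (_ , x<2+b) (inj₂ 2+b≤y) refl = <⇒≱ x<2+b 2+b≤y

  notLow≢low : ∀ {x y} → NotLow x → IsLow y → x ≢ y
  notLow≢low nx ly e = low≢notLow ly nx (sym e)

  low-IsLow : ∀ t → IsLow (low t)
  low-IsLow t = s≤s (s≤s z≤n) , s≤s (s≤s (m%n<n t b))

  high-NotLow : ∀ t → NotLow (high t)
  high-NotLow t = inj₂ (m≤m+n (2 + b) (t / b))

  <2⇒NotLow : ∀ {w} → All (_< 2) w → All NotLow w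
  <2⇒NotLow = All.map inj₁

  <2⇒high≢ : ∀ j {w} → All (_< 2) w → All (high j ≢_) w
  <2⇒high≢ j = All.map λ x<2 e → <⇒≱ x<2 (subst (2 ≤_) e (s≤s (s≤s z≤n)))

  notLow⇒low≢ : ∀ t {w} → All NotLow w → All (low t ≢_) w
  notLow⇒low≢ t = All.map (low≢notLow (low-IsLow t))

  high-low-injective : ∀ a j → high a ≡ high j → low a ≡ low j → a ≡ j
  high-low-injective a j eh el = begin
    a                   ≡⟨ m≡m%n+[m/n]*n a b ⟩
    a % b + (a / b) * b ≡⟨ cong₂ (λ x y → x + y * b) (suc-injective (suc-injective el)) (+-cancelˡ-≡ (2 + b) _ _ eh) ⟩
    j % b + (j / b) * b ≡⟨ sym (m≡m%n+[m/n]*n j b) ⟩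
    j                   ∎
    where open ≡-Reasoning

  high≢∨low≢ : ∀ {a j} → a ≢ j → high a ≢ high j ⊎ low a ≢ low j
  high≢∨low≢ {a} {j} a≢j with high a ≟ high j
  ... | no  hi≢ = inj₁ hi≢
  ... | yes hi≡ = inj₂ λ lo≡ → a≢j (high-low-injective a j hi≡ lo≡)

  low-periodic : ∀ t → low (t + b) ≡ low t
  low-periodic t = cong (2 +_) ([m+n]%n≡m%n t b)

  high-constant : ∀ a t → t < b → high (a * b + t) ≡ 2 + b + a
  high-constant a t t<b = cong (2 + b +_) (begin
    (a * b + t) / b   ≡⟨ +-distrib-/-∣ˡ t (n∣m*n a) ⟩
    a * b / b + t / b ≡⟨ cong₂ _+_ (m*n/n≡m a b) (m<n⇒m/n≡0 t<b) ⟩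
    a + 0             ≡⟨ +-identityʳ a ⟩
    a                 ∎)
    where open ≡-Reasoning

  lows highs : ℕ → Str
  lows  = applyDownFrom low
  highs = applyUpTo high

  highs-NotLow : ∀ n → All NotLow (highs n)
  highs-NotLow n = applyUpTo⁺₂ high n high-NotLow

  block : Str → ℕ → Str
  block u j = lows j ++ u ++ highs (suc j)

  blocks : Str → ℕ → ℕ → Str
  blocks u a zero    = []
  blocks u a (suc n) = block u a ++ blocks u (suc a) n

  header : Str → Str
  header m = lows k ++ m ++ highs k

  text : Str → Str → Str → Str
  text m u Z = header m ++ (blocks u 0 k ++ Z)

  junction : ℕ → Str
  junction j = high j ∷ low j ∷ []

  -- The letter following lows j in a block.
  lead : Str → ℕ
  lead []      = high 0
  lead (x ∷ _) = x

  lead-NotLow : ∀ {u} → All NotLow u → NotLow (lead u)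
  lead-NotLow {[]}    _        = high-NotLow 0
  lead-NotLow {_ ∷ _} (nx ∷ _) = nx

  ++highs-lead : ∀ u n V → ∃ λ V' → (u ++ highs (suc n)) ++ V ≡ lead u ∷ V'
  ++highs-lead []      n V = _ , refl
  ++highs-lead (x ∷ u) n V = _ , refl

  blockStart : Str → Str → ℕ → ℕ
  blockStart m u j = length (header m) + length (blocks u 0 j)

  junctionStart : Str → Str → ℕ → ℕ
  junctionStart m u j = blockStart m u j + (j + (length u + j))

  block-ending-high : ∀ u j S → (lows j ++ u ++ highs j) ++ high j ∷ S ≡ block u j ++ S
  block-ending-high u j S = begin
    (lows j ++ u ++ highs j) ++ high j ∷ S         ≡⟨ ++-assoc (lows j) _ _ ⟩
    lows j ++ (u ++ highs j) ++ high j ∷ S         ≡⟨ cong (lows j ++_) (++-assoc u (highs j) _) ⟩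
    lows j ++ u ++ highs j ++ high j ∷ S           ≡⟨ cong (λ x → lows j ++ u ++ x) (sym (++-assoc (highs j) (high j ∷ []) S)) ⟩
    lows j ++ u ++ (highs j ++ high j ∷ []) ++ S   ≡⟨ cong (λ x → lows j ++ u ++ x ++ S) (applyUpTo-∷ʳ high j) ⟩
    lows j ++ u ++ highs (suc j) ++ S              ≡⟨ cong (lows j ++_) (sym (++-assoc u _ S)) ⟩
    lows j ++ (u ++ highs (suc j)) ++ S            ≡⟨ sym (++-assoc (lows j) _ S) ⟩
    block u j ++ S                                 ∎
    where open ≡-Reasoning

  blocks-++ : ∀ u a m n → blocks u a (m + n) ≡ blocks u a m ++ blocks u (a + m) n
  blocks-++ u a zero    n = cong (λ x → blocks u x n) (sym (+-identityʳ a))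
  blocks-++ u a (suc m) n = begin
    block u a ++ blocks u (suc a) (m + n)                           ≡⟨ cong (block u a ++_) (blocks-++ u (suc a) m n) ⟩
    block u a ++ (blocks u (suc a) m ++ blocks u (suc a + m) n)     ≡⟨ cong (λ x → block u a ++ (blocks u (suc a) m ++ blocks u x n)) (sym (+-suc a m)) ⟩
    block u a ++ (blocks u (suc a) m ++ blocks u (a + suc m) n)     ≡⟨ sym (++-assoc (block u a) _ _) ⟩
    blocks u a (suc m) ++ blocks u (a + suc m) n                    ∎
    where open ≡-Reasoning

  blocks-++-lows : ∀ u a n V → ∃ λ V' → blocks u (suc a) n ++ lows (a + suc n) ++ V ≡ lows (suc a) ++ V'
  blocks-++-lows u a zero    V = V , cong (λ x → lows x ++ V) (+-comm a 1)
  blocks-++-lows u a (suc n) V = _ , trans (++-assoc (block u (suc a)) _ _) (++-assoc (lows (suc a)) _ _)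

  text-at : ∀ m u Z j n → j + suc n ≡ k → text m u Z ≡ (header m ++ blocks u 0 j) ++ block u j ++ blocks u (suc j) n ++ Z
  text-at m u Z j n j+1+n≡k = begin
    header m ++ (blocks u 0 k ++ Z)                             ≡⟨ cong (λ x → header m ++ (blocks u 0 x ++ Z)) (sym j+1+n≡k) ⟩
    header m ++ (blocks u 0 (j + suc n) ++ Z)                   ≡⟨ cong (λ x → header m ++ (x ++ Z)) (blocks-++ u 0 j (suc n)) ⟩
    header m ++ ((blocks u 0 j ++ block u j ++ blocks u (suc j) n) ++ Z) ≡⟨ cong (header m ++_) (++-assoc (blocks u 0 j) _ Z) ⟩
    header m ++ (blocks u 0 j ++ (block u j ++ blocks u (suc j) n) ++ Z) ≡⟨ sym (++-assoc (header m) _ _) ⟩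
    (header m ++ blocks u 0 j) ++ (block u j ++ blocks u (suc j) n) ++ Z ≡⟨ cong ((header m ++ blocks u 0 j) ++_) (++-assoc (block u j) _ Z) ⟩
    (header m ++ blocks u 0 j) ++ block u j ++ blocks u (suc j) n ++ Z ∎
    where open ≡-Reasoning

  text-at-block : ∀ m u Z j → 2 + j ≤ k →
    ∃ λ R → text m u Z ≡ (header m ++ blocks u 0 j) ++ block u j ++ low j ∷ R
  text-at-block m u Z j 2+j≤k with <-offset 2+j≤k
  ... | n , k≡ = _ , trans (text-at m u Z j (suc n) (sym (trans k≡ (sym (+-suc j (suc n))))))
    (cong (λ x → (header m ++ blocks u 0 j) ++ block u j ++ x) (++-assoc (block u (suc j)) _ Z))

  text-split : ∀ m u Z → text m u Z ≡ lows k ++ m ++ highs k ++ blocks u 0 k ++ Z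
  text-split m u Z = trans (++-assoc (lows k) (m ++ highs k) _) (cong (lows k ++_) (++-assoc m (highs k) _))

  length-header : ∀ m → length (header m) ≡ k + (length m + k)
  length-header m = trans (length-++ (lows k)) (cong₂ _+_ (length-applyDownFrom low k)
    (trans (length-++ m) (cong (length m +_) (length-applyUpTo high k))))

  length-block : ∀ u j → length (block u j) ≡ j + (length u + suc j)
  length-block u j = trans (length-++ (lows j)) (cong₂ _+_ (length-applyDownFrom low j)
    (trans (length-++ u) (cong (length u +_) (length-applyUpTo high (suc j)))))

  length-blocks-suc : ∀ u j → length (blocks u 0 (suc j)) ≡ length (blocks u 0 j) + length (block u j)
  length-blocks-suc u j = begin
    length (blocks u 0 (suc j))           ≡⟨ cong (λ x → length (blocks u 0 x)) (+-comm 1 j) ⟩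
    length (blocks u 0 (j + 1))           ≡⟨ cong length (blocks-++ u 0 j 1) ⟩
    length (blocks u 0 j ++ block u j ++ []) ≡⟨ length-++ (blocks u 0 j) ⟩
    length (blocks u 0 j) + length (block u j ++ []) ≡⟨ cong (λ x → length (blocks u 0 j) + length x) (++-identityʳ (block u j)) ⟩
    length (blocks u 0 j) + length (block u j) ∎
    where open ≡-Reasoning

  length-blocks : ∀ u j → length (blocks u 0 j) ≡ j * j + j * length u
  length-blocks u zero    = refl
  length-blocks u (suc j) = begin
    length (blocks u 0 (suc j))                         ≡⟨ length-blocks-suc u j ⟩
    length (blocks u 0 j) + length (block u j)          ≡⟨ cong₂ _+_ (length-blocks u j) (length-block u j) ⟩
    j * j + j * length u + (j + (length u + suc j))     ≡⟨ expand (length u) j ⟩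
    suc j * suc j + suc j * length u                    ∎
    where
    open ≡-Reasoning
    expand : ∀ c j → j * j + j * c + (j + (c + suc j)) ≡ suc j * suc j + suc j * c
    expand = solve-∀

  length-text : ∀ m u p → length (text m u (replicate p 0)) ≡ (k + (length m + k)) + (k * k + k * length u) + p
  length-text m u p = trans (length-++ (header m)) (trans (cong₂ _+_ (length-header m)
    (trans (length-++ (blocks u 0 k)) (cong₂ _+_ (length-blocks u k) (length-replicate p))))
    (sym (+-assoc (k + (length m + k)) (k * k + k * length u) p)))

  blockStart-suc : ∀ m u j → blockStart m u (suc j) ≡ blockStart m u j + (j + (length u + suc j))
  blockStart-suc m u j = trans (cong (length (header m) +_) (length-blocks-suc u j))
    (trans (sym (+-assoc (length (header m)) _ _)) (cong (blockStart m u j +_) (length-block u j)))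

  junctionStart+1 : ∀ m u j → junctionStart m u j + 1 ≡ blockStart m u (suc j)
  junctionStart+1 m u j = trans (shift (blockStart m u j) j (length u)) (sym (blockStart-suc m u j))
    where
    shift : ∀ x j c → x + (j + (c + j)) + 1 ≡ x + (j + (c + suc j))
    shift = solve-∀

  blockStart<length : ∀ m u Z j → 2 + j ≤ k → blockStart m u (suc j) < length (text m u Z)
  blockStart<length m u Z j 2+j≤k = begin-strict
    blockStart m u (suc j)                                ≡⟨ blockStart-suc m u j ⟩
    blockStart m u j + (j + (length u + suc j))           ≡⟨ cong₂ _+_ (sym (length-++ (header m))) (sym (length-block u j)) ⟩
    length (header m ++ blocks u 0 j) + length (block u j) <⟨ +-monoʳ-< (length (header m ++ blocks u 0 j)) (m<m+n (length (block u j)) z<s) ⟩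
    length (header m ++ blocks u 0 j) + (length (block u j) + length (low j ∷ R))
      ≡⟨ cong (length (header m ++ blocks u 0 j) +_) (sym (length-++ (block u j))) ⟩
    length (header m ++ blocks u 0 j) + length (block u j ++ low j ∷ R) ≡⟨ sym (length-++ (header m ++ blocks u 0 j)) ⟩
    length ((header m ++ blocks u 0 j) ++ block u j ++ low j ∷ R) ≡⟨ cong length (sym (proj₂ (text-at-block m u Z j 2+j≤k))) ⟩
    length (text m u Z)                                   ∎
    where
    open ≤-Reasoning
    R = proj₁ (text-at-block m u Z j 2+j≤k)

  junctionStart<length : ∀ m u Z j → 2 + j ≤ k → junctionStart m u j < length (text m u Z)
  junctionStart<length m u Z j 2+j≤k =
    <-trans (≤-reflexive (trans (+-comm 1 _) (junctionStart+1 m u j))) (blockStart<length m u Z j 2+j≤k)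

  lows+h⋠lows+z : ∀ j t {h z S} → NotLow h → NotLow z → t < j ⊎ z ≢ h → ¬ lows j ++ h ∷ [] ≼ lows t ++ z ∷ S
  lows+h⋠lows+z j t {h} {z} {S} nh nz cond with <-cmp t j
  ... | tri< t<j _ _ with <-offset t<j
  ...   | d , refl = mismatch⇒⋠ t (drop-applyDownFrom-++ low t (suc d) _) (drop-applyDownFrom-++-self low t _)
                       (low≢notLow (low-IsLow d) nz)
  lows+h⋠lows+z j t nh nz (inj₁ t<t) | tri≈ _ refl _ = ⊥-elim (<-irrefl refl t<t)
  lows+h⋠lows+z j t nh nz (inj₂ z≢h) | tri≈ _ refl _ =
    mismatch⇒⋠ t (drop-applyDownFrom-++-self low t _) (drop-applyDownFrom-++-self low t _) (λ e → z≢h (sym e))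
  lows+h⋠lows+z j t nh nz cond | tri> _ _ j<t with <-offset j<t
  ...   | d , refl = mismatch⇒⋠ j (drop-applyDownFrom-++-self low j _) (drop-applyDownFrom-++ low j (suc d) _)
                       (notLow≢low nh (low-IsLow d))

  lows-avoid-lows+h : ∀ j t {h z} V → NotLow h → NotLow z → t < j ⊎ z ≢ h → Avoids (lows j ++ h ∷ []) (lows t) (z ∷ V)
  lows-avoid-lows+h j zero    V nh nz cond = Avoids-[] _ _
  lows-avoid-lows+h j (suc t) V nh nz cond =
    Avoids-∷ _ (low t) (lows t) _ (lows+h⋠lows+z j (suc t) nh nz cond)
      (lows-avoid-lows+h j t V nh nz (map₁ (<-trans (n<1+n t)) cond))

  lows++-avoid-lows+h : ∀ j t w V {h z V'} → NotLow h → NotLow z → w ++ V ≡ z ∷ V' → t < suc j ⊎ z ≢ h →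
                        All NotLow w → Avoids (lows (suc j) ++ h ∷ []) (lows t ++ w) V
  lows++-avoid-lows+h j t w V nh nz e cond nw =
    Avoids-++ _ (lows t) w V
      (subst (Avoids _ (lows t)) (sym e) (lows-avoid-lows+h (suc j) t _ nh nz cond))
      (Avoids-head (low j) (lows j ++ _ ∷ []) w V (notLow⇒low≢ j nw))

  blocks-avoid : ∀ W u a n V → (∀ a' → a' < a + n → ∀ V' → Avoids W (block u a') (lows (suc a') ++ V')) →
                 Avoids W (blocks u a n) (lows (a + n) ++ V)
  blocks-avoid W u a zero    V each = Avoids-[] _ _
  blocks-avoid W u a (suc n) V each =
    Avoids-++ W (block u a) (blocks u (suc a) n) _ first
      (subst (λ x → Avoids W (blocks u (suc a) n) (lows x ++ V)) (sym (+-suc a n))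
        (blocks-avoid W u (suc a) n V λ a' lt → each a' (subst (a' <_) (sym (+-suc a n)) lt)))
    where
    first : Avoids W (block u a) (blocks u (suc a) n ++ lows (a + suc n) ++ V)
    first = let (V' , e) = blocks-++-lows u a n V in subst (Avoids W (block u a)) (sym e) (each a (m<m+n a z<s) V')

  lows++highs-avoid-junction : ∀ j t w n z V → All (high j ≢_) w → high n ≢ high j ⊎ z ≢ low j →
                               Avoids (junction j) (lows t ++ w ++ highs (suc n)) (z ∷ V)
  lows++highs-avoid-junction j t w n z V hw cond =
    Avoids-++ _ (lows t) _ _
      (Avoids-head (high j) _ (lows t) _ (applyDownFrom⁺₂ low t (λ t → notLow≢low (high-NotLow j) (low-IsLow t))))
      (Avoids-++ _ w _ _ (Avoids-head (high j) _ w _ hw)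
        (applyUpTo-avoids-pair high n z V (λ t → notLow≢low (high-NotLow t) (low-IsLow j)) cond))

  block-avoids-0+highs : ∀ j a V → a < j → Avoids (0 ∷ highs (suc j)) (block (0 ∷ []) a) (lows (suc a) ++ V)
  block-avoids-0+highs j a V a<j with <-offset a<j
  ... | d , refl =
    Avoids-++ _ (lows a) _ _
      (Avoids-head 0 _ (lows a) _ (applyDownFrom⁺₂ low a λ _ ()))
      (Avoids-∷ _ 0 (highs (suc a)) _ highs-diverge
        (Avoids-head 0 _ (highs (suc a)) _ (applyUpTo⁺₂ high (suc a) λ _ ())))
    where
    highs-diverge : ¬ 0 ∷ highs (suc (a + suc d)) ≼ 0 ∷ highs (suc a) ++ lows (suc a) ++ V
    highs-diverge = mismatch⇒⋠ (suc (suc a)) (drop-applyUpTo high (suc a) (suc d))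
      (subst (λ x → drop x (highs (suc a) ++ lows (suc a) ++ V) ≡ low a ∷ lows a ++ V)
             (length-applyUpTo high (suc a)) (drop-length-++ (highs (suc a)) _))
      (notLow≢low (high-NotLow (suc a + 0)) (low-IsLow a))

  -- Earlier copies of lows j are followed by lead m (header) or cut short by a non-low letter (block a < j).
  novel-lows+lead : ∀ m u Z j₀ → 2 + suc j₀ ≤ k → All (_< 2) m → All (_< 2) u → lead m ≢ lead u →
                    Novel (text m u Z) (blockStart m u (suc j₀)) (suc (suc j₀))
  novel-lows+lead m u Z j₀ 2+j≤k m<2 u<2 lead≢ =
    Novel-cast (sym text≡) (length-++ (header m))
      (trans (length-++ (lows j)) (trans (cong (_+ 1) (length-applyDownFrom low j)) (+-comm j 1)))
      (avoids⇒novel U V W W≼V (Avoids-++ W (header m) (blocks u 0 j) V inHeader inBlocks))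
    where
    j = suc j₀
    R = proj₁ (text-at-block m u Z j 2+j≤k)
    text≡ = proj₂ (text-at-block m u Z j 2+j≤k)
    U = header m ++ blocks u 0 j
    V = block u j ++ low j ∷ R
    W = lows j ++ lead u ∷ []
    nu = <2⇒NotLow u<2
    V≡ : V ≡ lows j ++ (u ++ highs (suc j)) ++ low j ∷ R
    V≡ = ++-assoc (lows j) _ _
    W≼V : W ≼ V
    W≼V = let (V' , e) = ++highs-lead u j (low j ∷ R) in
      subst (W ≼_) (sym V≡) (++⁺-≼ (lows j) (V' , e))
    inHeader : Avoids W (header m) (blocks u 0 j ++ V)
    inHeader = let (V' , e) = ++highs-lead m (b' + b' * b) (blocks u 0 j ++ V) in
      lows++-avoid-lows+h j₀ k (m ++ highs k) _ (lead-NotLow nu) (lead-NotLow (<2⇒NotLow m<2)) e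
        (inj₂ lead≢) (++⁺ (<2⇒NotLow m<2) (highs-NotLow k))
    inBlocks : Avoids W (blocks u 0 j) V
    inBlocks = subst (Avoids W (blocks u 0 j)) (sym V≡) (blocks-avoid W u 0 j _ λ a a<j V' →
      let (V'' , e) = ++highs-lead u a (lows (suc a) ++ V') in
      lows++-avoid-lows+h j₀ a (u ++ highs (suc a)) _ (lead-NotLow nu) (lead-NotLow nu) e (inj₁ a<j)
        (++⁺ nu (highs-NotLow (suc a))))

  -- In a block a < j, the factor 0 · highs (a + 1) is followed by low a instead of high (a + 1).
  novel-0+highs : ∀ m Z j → 2 + j ≤ k → All (0 ≢_) m →
                  Novel (text m (0 ∷ []) Z) (blockStart m (0 ∷ []) j + j) (suc (suc j))
  novel-0+highs m Z j 2+j≤k 0∉m =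
    Novel-cast text≡ length-U (cong suc (length-applyUpTo high (suc j)))
      (avoids⇒novel U V W (≼-++ʳ W _)
        (Avoids-++ W (header m) _ V
          (Avoids-head 0 _ (header m) _ (++⁺ (lows-0∉ {k}) (++⁺ 0∉m (applyUpTo⁺₂ high k λ _ ()))))
          (Avoids-++ W (blocks u 0 j) (lows j) V
            (blocks-avoid W u 0 j V λ a a<j V' → block-avoids-0+highs j a V' a<j)
            (Avoids-head 0 _ (lows j) V (lows-0∉)))))
    where
    u = 0 ∷ []
    R = proj₁ (text-at-block m u Z j 2+j≤k)
    W = 0 ∷ highs (suc j)
    V = W ++ low j ∷ R
    U = header m ++ (blocks u 0 j ++ lows j)
    lows-0∉ : ∀ {n} → All (0 ≢_) (lows n)
    lows-0∉ {n} = applyDownFrom⁺₂ low n λ _ ()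
    text≡ : U ++ V ≡ text m u Z
    text≡ = begin
      (header m ++ (blocks u 0 j ++ lows j)) ++ V ≡⟨ ++-assoc (header m) _ V ⟩
      header m ++ ((blocks u 0 j ++ lows j) ++ V) ≡⟨ cong (header m ++_) (++-assoc (blocks u 0 j) (lows j) V) ⟩
      header m ++ (blocks u 0 j ++ lows j ++ V)   ≡⟨ sym (++-assoc (header m) _ _) ⟩
      (header m ++ blocks u 0 j) ++ lows j ++ V   ≡⟨ cong ((header m ++ blocks u 0 j) ++_) (sym (++-assoc (lows j) W _)) ⟩
      (header m ++ blocks u 0 j) ++ block u j ++ low j ∷ R ≡⟨ sym (proj₂ (text-at-block m u Z j 2+j≤k)) ⟩
      text m u Z ∎
      where open ≡-Reasoning
    length-U : length U ≡ blockStart m u j + j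
    length-U = trans (length-++ (header m)) (trans (cong (length (header m) +_)
      (trans (length-++ (blocks u 0 j)) (cong (length (blocks u 0 j) +_) (length-applyDownFrom low j))))
      (sym (+-assoc (length (header m)) _ j)))

  -- The junction high a · low a after block a determines a; elsewhere high letters are followed by non-low ones.
  novel-junction : ∀ m u Z j₀ → 2 + suc j₀ ≤ k → All (_< 2) m → All (_< 2) u →
                   Novel (text m u Z) (junctionStart m u (suc j₀)) 2
  novel-junction m u Z j₀ 2+j≤k m<2 u<2 =
    Novel-cast text≡ length-U refl
      (avoids⇒novel U V (junction j) (≼-++ʳ (junction j) R)
        (Avoids-++ _ (header m ++ blocks u 0 j) body V
          (Avoids-++ _ (header m) (blocks u 0 j) _ inHeader inBlocks)
          (lows++highs-avoid-junction j j u j₀ (high j) (low j ∷ R) hu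
             (inj₂ (notLow≢low (high-NotLow j) (low-IsLow j))))))
    where
    j = suc j₀
    R = proj₁ (text-at-block m u Z j 2+j≤k)
    body = lows j ++ u ++ highs j
    U = (header m ++ blocks u 0 j) ++ body
    V = high j ∷ low j ∷ R
    hu = <2⇒high≢ j u<2
    inHeader : Avoids (junction j) (header m) (blocks u 0 j ++ body ++ V)
    inHeader = let (V' , e) = ++highs-lead u 0 (blocks u 1 j₀ ++ body ++ V) in
      subst (Avoids _ (header m)) (sym (trans (++-assoc (block u 0) _ _) e))
        (lows++highs-avoid-junction j k m (b' + b' * b) (lead u) V' (<2⇒high≢ j m<2)
          (inj₂ (notLow≢low (lead-NotLow (<2⇒NotLow u<2)) (low-IsLow j))))
    inBlocks : Avoids (junction j) (blocks u 0 j) (body ++ V)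
    inBlocks = subst (Avoids _ (blocks u 0 j)) (sym (++-assoc (lows j) _ V))
      (blocks-avoid _ u 0 j _ λ a a<j V' → lows++highs-avoid-junction j a u a (low a) (lows a ++ V') hu
        (high≢∨low≢ (<⇒≢ a<j)))
    text≡ : U ++ V ≡ text m u Z
    text≡ = trans (++-assoc (header m ++ blocks u 0 j) body V)
      (trans (cong ((header m ++ blocks u 0 j) ++_) (block-ending-high u j (low j ∷ R)))
        (sym (proj₂ (text-at-block m u Z j 2+j≤k))))
    length-U : length U ≡ junctionStart m u j
    length-U = trans (length-++ (header m ++ blocks u 0 j)) (cong₂ _+_ (length-++ (header m))
      (trans (length-++ (lows j)) (cong₂ _+_ (length-applyDownFrom low j)
        (trans (length-++ u) (cong (length u +_) (length-applyUpTo high j))))))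

  junction-window : ∀ m u Z j₀ {a n} → 2 + suc j₀ ≤ k → All (_< 2) m → All (_< 2) u → a ≤ junctionStart m u (suc j₀) →
    Barriers (text m u Z) (blockStart m u (2 + j₀)) n → Barriers (text m u Z) a (suc n)
  junction-window m u Z j₀ {n = n} 2+j≤k m<2 u<2 a≤ rest =
    novel-window _ 0 (novel-junction m u Z j₀ 2+j≤k m<2 u<2) a≤
      (subst (_< length (text m u Z)) (sym (junctionStart+1 m u (suc j₀))) (blockStart<length m u Z (suc j₀) 2+j≤k))
      (subst (λ i → Barriers (text m u Z) i n) (sym (junctionStart+1 m u (suc j₀))) rest)

  substituted-windows : ∀ m Z j₀ {n} → 2 + suc j₀ ≤ k → All (_< 2) m → All (0 ≢_) m → lead m ≢ 0 →
    Barriers (text m (0 ∷ []) Z) (blockStart m (0 ∷ []) (2 + j₀)) n →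
    Barriers (text m (0 ∷ []) Z) (blockStart m (0 ∷ []) (suc j₀)) (3 + n)
  substituted-windows m Z j₀ 2+j≤k m<2 0∉m lead≢0 rest =
    novel-window x j₀ (novel-lows+lead m u Z j₀ 2+j≤k m<2 u<2 lead≢0) ≤-refl (inside (+-monoʳ-≤ x (m≤m+n j _)))
      (novel-window (x + j) j (novel-0+highs m Z j 2+j≤k 0∉m) ≤-refl (inside (≤-reflexive (+-assoc x j (suc j))))
        (junction-window m u Z j₀ 2+j≤k m<2 u<2 (≤-reflexive (+-assoc x j (suc j))) rest))
    where
    u = 0 ∷ []
    u<2 = z<s ∷ []
    j = suc j₀
    x = blockStart m u j
    inside : ∀ {h} → h ≤ junctionStart m u j → h < length (text m u Z)
    inside h≤ = ≤-<-trans h≤ (junctionStart<length m u Z j 2+j≤k)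

  inserted-windows : ∀ m Z j₀ {n} → 2 + suc j₀ ≤ k → All (_< 2) m → lead m ≢ high 0 →
    Barriers (text m [] Z) (blockStart m [] (2 + j₀)) n →
    Barriers (text m [] Z) (blockStart m [] (suc j₀)) (2 + n)
  inserted-windows m Z j₀ 2+j≤k m<2 lead≢ rest =
    novel-window x j₀ (novel-lows+lead m [] Z j₀ 2+j≤k m<2 [] lead≢) ≤-refl
      (≤-<-trans x+j≤ (junctionStart<length m [] Z j 2+j≤k))
      (junction-window m [] Z j₀ 2+j≤k m<2 [] x+j≤ rest)
    where
    j = suc j₀
    x = blockStart m [] j
    x+j≤ : x + j ≤ junctionStart m [] j
    x+j≤ = +-monoʳ-≤ x (m≤m+n j j)

  -- Blocks 1 … k − 2 each supply c windows, lying between their own start and that of the next block.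
  stack : ∀ m u Z c → (∀ j₀ {n} → 2 + suc j₀ ≤ k →
            Barriers (text m u Z) (blockStart m u (2 + j₀)) n → Barriers (text m u Z) (blockStart m u (suc j₀)) (c + n)) →
          (k ∸ 2) * c ≤ zSSsr (text m u Z)
  stack m u Z c window = Barriers⇒≤zSSsr (Barriers-stack (blockStart m u) c 1 (k ∸ 2) λ where
    (suc j₀) n _ (s≤s j<) → window j₀ (interior k j<))
    where
    interior : ∀ n {j} → suc j ≤ n ∸ 2 → 2 + suc j ≤ n
    interior (suc (suc n)) j≤ = s≤s (s≤s j≤)

  junctions≤zSSsr : ∀ m u Z → All (_< 2) m → All (_< 2) u → k ∸ 2 ≤ zSSsr (text m u Z)
  junctions≤zSSsr m u Z m<2 u<2 = subst (_≤ zSSsr (text m u Z)) (*-identityʳ (k ∸ 2))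
    (stack m u Z 1 λ j₀ 2+j≤k → junction-window m u Z j₀ 2+j≤k m<2 u<2 (m≤m+n _ _))

  substituted≤zSSsr : ∀ m Z → All (_< 2) m → All (0 ≢_) m → lead m ≢ 0 → 3 * (k ∸ 2) ≤ zSSsr (text m (0 ∷ []) Z)
  substituted≤zSSsr m Z m<2 0∉m lead≢0 = subst (_≤ zSSsr (text m (0 ∷ []) Z)) (*-comm (k ∸ 2) 3)
    (stack m (0 ∷ []) Z 3 λ j₀ 2+j≤k → substituted-windows m Z j₀ 2+j≤k m<2 0∉m lead≢0)

  inserted≤zSSsr : ∀ m Z → All (_< 2) m → lead m ≢ high 0 → 2 * (k ∸ 2) ≤ zSSsr (text m [] Z)
  inserted≤zSSsr m Z m<2 lead≢ = subst (_≤ zSSsr (text m [] Z)) (*-comm (k ∸ 2) 2)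
    (stack m [] Z 2 λ j₀ 2+j≤k → inserted-windows m Z j₀ 2+j≤k m<2 lead≢)

  -- lows k has period b: after b fresh letters, the rest is one copy from position 0.
  lows-parse : ∀ R → Parse (lows k ++ R) 0 k (b + 1)
  lows-parse R = fresh-parse X 0 b ◅◅
    (copy 0 (lows n) z<s source target ◅ Parse-cast refl refl (trans (cong (b +_) (length-applyDownFrom low n)) k≡) refl ε)
    where
    X = lows k ++ R
    n = k ∸ b
    k≡ : b + n ≡ k
    k≡ = m+[n∸m]≡n (m≤m*n b b)
    source : lows n ≼ X
    source = ≼-trans (applyDownFrom-periodic low b low-periodic n)
      (subst (λ x → lows (n + b) ≼ lows x ++ R) (trans (+-comm n b) k≡) (≼-++ʳ _ R))
    target : lows n ≼ drop b X
    target = subst (λ x → lows n ≼ drop b (lows x ++ R)) k≡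
      (subst (lows n ≼_) (sym (drop-applyDownFrom-++ low b n R)) (≼-++ʳ _ R))

  highs-run-parse : ∀ A R a → a < b → Parse (A ++ highs k ++ R) (length A + a * b) (length A + a * b + b) 2
  highs-run-parse A R a a<b = run-parse (A ++ highs k ++ R) _ (2 + b + a) b' run
    where
    d = proj₁ (<-offset a<b)
    g : ℕ → ℕ
    g t = high (a * b + t)
    k≡ : k ≡ a * b + (b + d * b)
    k≡ = trans (cong (_* b) (trans (proj₂ (<-offset a<b)) (+-suc a d))) (split a d b)
      where
      split : ∀ a d b → (suc a + d) * b ≡ a * b + (b + d * b)
      split = solve-∀
    run : drop (length A + a * b) (A ++ highs k ++ R) ≡ replicate b (2 + b + a) ++ applyUpTo (λ t → g (b + t)) (d * b) ++ R
    run = begin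
      drop (length A + a * b) (A ++ highs k ++ R)          ≡⟨ sym (drop-drop (length A) (a * b) _) ⟩
      drop (a * b) (drop (length A) (A ++ highs k ++ R))   ≡⟨ cong (drop (a * b)) (drop-length-++ A _) ⟩
      drop (a * b) (highs k ++ R)                          ≡⟨ cong (λ x → drop (a * b) (highs x ++ R)) k≡ ⟩
      drop (a * b) (highs (a * b + (b + d * b)) ++ R)      ≡⟨ cong (λ x → drop (a * b) (x ++ R)) (applyUpTo-++ high (a * b) _) ⟩
      drop (a * b) ((highs (a * b) ++ applyUpTo g (b + d * b)) ++ R) ≡⟨ cong (drop (a * b)) (++-assoc (highs (a * b)) _ R) ⟩
      drop (a * b) (highs (a * b) ++ applyUpTo g (b + d * b) ++ R)   ≡⟨ drop-applyUpTo-++-self high (a * b) _ ⟩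
      applyUpTo g (b + d * b) ++ R                         ≡⟨ cong (_++ R) (applyUpTo-++ g b (d * b)) ⟩
      (applyUpTo g b ++ applyUpTo (λ t → g (b + t)) (d * b)) ++ R ≡⟨ ++-assoc (applyUpTo g b) _ R ⟩
      applyUpTo g b ++ applyUpTo (λ t → g (b + t)) (d * b) ++ R  ≡⟨ cong (_++ applyUpTo (λ t → g (b + t)) (d * b) ++ R) (applyUpTo-const g _ b (high-constant a)) ⟩
      replicate b (2 + b + a) ++ applyUpTo (λ t → g (b + t)) (d * b) ++ R ∎
      where open ≡-Reasoning

  highs-parse : ∀ A R a → a ≤ b → Parse (A ++ highs k ++ R) (length A) (length A + a * b) (a * 2)
  highs-parse A R zero    _     = Parse-cast refl refl (sym (+-identityʳ _)) refl ε
  highs-parse A R (suc a) 1+a≤b =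
    Parse-cast refl refl (trans (+-assoc (length A) (a * b) b) (cong (length A +_) (+-comm (a * b) b))) (+-comm (a * 2) 2)
      (highs-parse A R a (<⇒≤ 1+a≤b) ◅◅ highs-run-parse A R a 1+a≤b)

  block-copy : ∀ u Z j → j < k → Phrase (text u u Z) (blockStart u u j) (blockStart u u (suc j))
  block-copy u Z j j<k = subst (Phrase X (blockStart u u j)) end (copy (k ∸ j) (block u j) source<start source target)
    where
    X = text u u Z
    d = proj₁ (<-offset j<k)
    k≡ : k ≡ j + suc d
    k≡ = proj₂ (<-offset j<k)
    Y = blocks u 0 k ++ Z
    end : blockStart u u j + length (block u j) ≡ blockStart u u (suc j)
    end = trans (cong (blockStart u u j +_) (length-block u j)) (sym (blockStart-suc u u j))
    source<start : k ∸ j < blockStart u u j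
    source<start = ≤-<-trans (m∸n≤m k j) (<-≤-trans (m<m+n k (<-≤-trans z<s (m≤n+m k (length u))))
      (≤-trans (≤-reflexive (sym (length-header u))) (m≤m+n _ _)))
    highs≼ : highs (suc j) ≼ highs k ++ Y
    highs≼ = subst (λ x → highs (suc j) ≼ highs x ++ Y) (trans (sym (+-suc j d)) (sym k≡))
      (≼-trans (_ , applyUpTo-++ high (suc j) d) (≼-++ʳ _ Y))
    source : block u j ≼ drop (k ∸ j) X
    source = subst (block u j ≼_) (sym (trans (cong (drop (k ∸ j)) (++-assoc (lows k) (u ++ highs k) Y))
        (subst (λ x → drop (k ∸ j) (lows x ++ (u ++ highs k) ++ Y) ≡ lows j ++ (u ++ highs k) ++ Y)
          (m∸n+n≡m (<⇒≤ j<k)) (drop-applyDownFrom-++ low (k ∸ j) j _))))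
      (subst (λ x → block u j ≼ lows j ++ x) (sym (++-assoc u (highs k) Y)) (++⁺-≼ (lows j) (++⁺-≼ u highs≼)))
    target : block u j ≼ drop (blockStart u u j) X
    target = subst (λ x → block u j ≼ drop x X) (length-++ (header u) {blocks u 0 j})
      (subst (block u j ≼_)
        (sym (trans (cong (drop (length (header u ++ blocks u 0 j))) (text-at u u Z j d (sym k≡)))
                    (drop-length-++ (header u ++ blocks u 0 j) _)))
        (≼-++ʳ (block u j) _))

  blocks-parse : ∀ u Z j n → j + n ≤ k → Parse (text u u Z) (blockStart u u j) (blockStart u u (j + n)) n
  blocks-parse u Z j zero    _      = Parse-cast refl refl (cong (blockStart u u) (sym (+-identityʳ j))) refl ε
  blocks-parse u Z j (suc n) j+n<k =
    block-copy u Z j (<-≤-trans (m<m+n j z<s) j+n<k) ◅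
      Parse-cast refl refl (cong (blockStart u u) (sym (+-suc j n))) refl
        (blocks-parse u Z (suc j) n (subst (_≤ k) (+-suc j n) j+n<k))

  zeros-parse : ∀ S p → ∃ λ c → c ≤ 2 × Parse (S ++ replicate p 0) (length S) (length S + p) c
  zeros-parse S zero    = 0 , z≤n , Parse-cast refl refl (sym (+-identityʳ _)) refl ε
  zeros-parse S (suc p) = 2 , ≤-refl , run-parse _ (length S) 0 p
    (trans (drop-length-++ S _) (cong (0 ∷_) (sym (++-identityʳ (replicate p 0)))))

  zSSsr-text≤ : ∀ u p → length u ≤ 1 → zSSsr (text u u (replicate p 0)) ≤ k + (3 * b + 4)
  zSSsr-text≤ u p |u|≤1 = ≤-trans (zSSsr≤Parse whole) (≤-trans count≤ (≤-reflexive (total b k)))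
    where
    Z = replicate p 0
    X = text u u Z
    Y = blocks u 0 k ++ Z
    zeros = zeros-parse (header u ++ blocks u 0 k) p
    length-prefix : length (lows k ++ u) ≡ k + length u
    length-prefix = trans (length-++ (lows k)) (cong (_+ length u) (length-applyDownFrom low k))
    regroup : (lows k ++ u) ++ highs k ++ Y ≡ X
    regroup = sym (trans (++-assoc (lows k) _ Y) (trans (cong (lows k ++_) (++-assoc u (highs k) Y))
      (sym (++-assoc (lows k) u _))))
    highs-end : length (lows k ++ u) + b * b ≡ blockStart u u 0
    highs-end = trans (cong (_+ k) length-prefix)
      (trans (+-assoc k (length u) k) (trans (sym (length-header u)) (sym (+-identityʳ _))))
    inHeader : Parse X 0 (blockStart u u 0) ((b + 1) + (length u + b * 2))
    inHeader =
      Parse-cast (sym (++-assoc (lows k) _ Y)) refl refl refl (lows-parse _) ◅◅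
      fresh-parse X k (length u) ◅◅
      Parse-cast regroup length-prefix highs-end refl (highs-parse (lows k ++ u) Y b ≤-refl)
    whole : Parse X 0 (length X) (((b + 1) + (length u + b * 2)) + (k + proj₁ zeros))
    whole = inHeader ◅◅ blocks-parse u Z 0 k ≤-refl ◅◅
      Parse-cast (++-assoc (header u) (blocks u 0 k) Z) (length-++ (header u))
        (trans (cong (length (header u ++ blocks u 0 k) +_) (sym (length-replicate p)))
          (trans (sym (length-++ (header u ++ blocks u 0 k))) (cong length (++-assoc (header u) _ Z))))
        refl (proj₂ (proj₂ zeros))
    count≤ : ((b + 1) + (length u + b * 2)) + (k + proj₁ zeros) ≤ (b + 1) + (1 + b * 2) + (k + 2)
    count≤ = +-mono-≤ (+-monoʳ-≤ (b + 1) (+-monoˡ-≤ (b * 2) |u|≤1)) (+-monoʳ-≤ k (proj₁ (proj₂ zeros)))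
    total : ∀ b k → (b + 1) + (1 + b * 2) + (k + 2) ≡ k + (3 * b + 4)
    total = solve-∀

  substitution : ∀ u Z → OneEdit sub (text (0 ∷ []) u Z) (text (1 ∷ []) u Z)
  substitution u Z = subst₂ (OneEdit sub) (sym (text-split (0 ∷ []) u Z)) (sym (text-split (1 ∷ []) u Z))
    (≤1∧≢⇒ed≡1 _ _ (≤-trans (ed-++ˡ (lows k) (0 ∷ S) (1 ∷ S)) (ed-substitute 0 1 S)) differ ,
     trans (length-++ (lows k)) (sym (length-++ (lows k))))
    where
    S = highs k ++ blocks u 0 k ++ Z
    differ : lows k ++ 0 ∷ S ≢ lows k ++ 1 ∷ S
    differ e with ++-cancelˡ (lows k) (0 ∷ S) (1 ∷ S) e
    ... | ()

  deletion : ∀ u Z → OneEdit del (text (0 ∷ []) u Z) (text [] u Z)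
  deletion u Z = subst₂ (OneEdit del) (sym (text-split (0 ∷ []) u Z)) (sym (text-split [] u Z))
    (≤1∧≢⇒ed≡1 (lows k ++ 0 ∷ S) (lows k ++ S) (≤-trans (ed-++ˡ (lows k) (0 ∷ S) S) (ed-delete 0 S))
       (λ e → 1+n≢n (trans longer (cong length e))) ,
     longer)
    where
    S = highs k ++ blocks u 0 k ++ Z
    longer : suc (length (lows k ++ S)) ≡ length (lows k ++ 0 ∷ S)
    longer = sym (length-++-sucʳ (lows k) 0 S)

  insertion : ∀ u Z → OneEdit ins (text [] u Z) (text (1 ∷ []) u Z)
  insertion u Z = subst₂ (OneEdit ins) (sym (text-split [] u Z)) (sym (text-split (1 ∷ []) u Z))
    (≤1∧≢⇒ed≡1 (lows k ++ S) (lows k ++ 1 ∷ S) (≤-trans (ed-++ˡ (lows k) S (1 ∷ S)) (ed-insert 1 S))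
       (λ e → 1+n≢n (trans (sym longer) (sym (cong length e)))) ,
     longer)
    where
    S = highs k ++ blocks u 0 k ++ Z
    longer : length (lows k ++ 1 ∷ S) ≡ suc (length (lows k ++ S))
    longer = length-++-sucʳ (lows k) 1 S

square : ℕ → ℕ
square b' = suc b' * suc b'

record Blowup (kind : EditKind) (A : ℕ) (len : ℕ → ℕ) (b' p : ℕ) : Set where
  field
    T T'     : Str
    length-T : length T ≡ len b' + p
    one-edit : OneEdit kind T T'
    z≤       : zSSsr T ≤ square b' + (3 * suc b' + 4)
    ≤z       : square b' ∸ 2 ≤ zSSsr T
    ≤z'      : A * (square b' ∸ 2) ≤ zSSsr T'

text-length : ℕ → ℕ → ℕ
text-length c b' = (square b' + (c + square b')) + (square b' * square b' + square b' * c)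

substitution-blowup : ∀ b' p → Blowup sub 3 (text-length 1) b' p
substitution-blowup b' p = record
  { T = text (0 ∷ []) (0 ∷ []) Z ; T' = text (1 ∷ []) (0 ∷ []) Z
  ; length-T = length-text (0 ∷ []) (0 ∷ []) p
  ; one-edit = substitution (0 ∷ []) Z
  ; z≤ = zSSsr-text≤ (0 ∷ []) p (s≤s z≤n)
  ; ≤z = junctions≤zSSsr (0 ∷ []) (0 ∷ []) Z (z<s ∷ []) (z<s ∷ [])
  ; ≤z' = substituted≤zSSsr (1 ∷ []) Z (s≤s (s≤s z≤n) ∷ []) ((λ ()) ∷ []) (λ ()) }
  where
  open Construction b'
  Z = replicate p 0

deletion-blowup : ∀ b' p → Blowup del 3 (text-length 1) b' p
deletion-blowup b' p = record
  { T = text (0 ∷ []) (0 ∷ []) Z ; T' = text [] (0 ∷ []) Z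
  ; length-T = length-text (0 ∷ []) (0 ∷ []) p
  ; one-edit = deletion (0 ∷ []) Z
  ; z≤ = zSSsr-text≤ (0 ∷ []) p (s≤s z≤n)
  ; ≤z = junctions≤zSSsr (0 ∷ []) (0 ∷ []) Z (z<s ∷ []) (z<s ∷ [])
  ; ≤z' = substituted≤zSSsr [] Z [] [] (λ ()) }
  where
  open Construction b'
  Z = replicate p 0

insertion-blowup : ∀ b' p → Blowup ins 2 (text-length 0) b' p
insertion-blowup b' p = record
  { T = text [] [] Z ; T' = text (1 ∷ []) [] Z
  ; length-T = length-text [] [] p
  ; one-edit = insertion [] Z
  ; z≤ = zSSsr-text≤ [] p z≤n
  ; ≤z = junctions≤zSSsr [] [] Z [] []
  ; ≤z' = inserted≤zSSsr (1 ∷ []) Z (s≤s (s≤s z≤n) ∷ []) (λ ()) }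
  where
  open Construction b'
  Z = replicate p 0

≤∸2⇒≤+2 : ∀ K z → 2 ≤ K → K ∸ 2 ≤ z → K ≤ z + 2
≤∸2⇒≤+2 K z 2≤K le = ≤-trans (≤-reflexive (sym (m∸n+n≡m 2≤K))) (+-monoˡ-≤ 2 le)

*∸2⇒*≤ : ∀ A K z → 2 ≤ K → A * (K ∸ 2) ≤ z → A * K ≤ z + A * 2
*∸2⇒*≤ A K z 2≤K le = begin
  A * K                ≡⟨ cong (A *_) (sym (m∸n+n≡m 2≤K)) ⟩
  A * ((K ∸ 2) + 2)    ≡⟨ *-distribˡ-+ A (K ∸ 2) 2 ⟩
  A * (K ∸ 2) + A * 2  ≤⟨ +-monoˡ-≤ (A * 2) le ⟩
  z + A * 2            ∎
  where open ≤-Reasoning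

ratio-bound : ∀ A E z z' K C → z ≤ K + C → A * (K ∸ 2) ≤ z' → K ∸ 2 ≤ z → 2 ≤ K →
              A * E * C + A * 2 * E + 2 < K → A * E * z < E * z' + z
ratio-bound A E z z' K C z≤ ≤z' ≤z 2≤K slack = +-cancelʳ-< (A * 2 * E + 2) (A * E * z) (E * z' + z) (begin-strict
  A * E * z + (A * 2 * E + 2)                ≤⟨ +-monoˡ-≤ (A * 2 * E + 2) (*-monoʳ-≤ (A * E) z≤) ⟩
  A * E * (K + C) + (A * 2 * E + 2)          ≡⟨ regroup₁ A E K C ⟩
  A * E * K + (A * E * C + A * 2 * E + 2)    <⟨ +-monoʳ-< (A * E * K) slack ⟩
  A * E * K + K                              ≡⟨ cong (_+ K) (regroup₂ A E K) ⟩
  E * (A * K) + K                            ≤⟨ +-mono-≤ (*-monoʳ-≤ E (*∸2⇒*≤ A K z' 2≤K ≤z')) (≤∸2⇒≤+2 K z 2≤K ≤z) ⟩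
  E * (z' + A * 2) + (z + 2)                 ≡⟨ regroup₃ E z' A z ⟩
  E * z' + z + (A * 2 * E + 2)               ∎)
  where
  open ≤-Reasoning
  regroup₁ : ∀ A E K C → A * E * (K + C) + (A * 2 * E + 2) ≡ A * E * K + (A * E * C + A * 2 * E + 2)
  regroup₁ = solve-∀
  regroup₂ : ∀ A E K → A * E * K ≡ E * (A * K)
  regroup₂ = solve-∀
  regroup₃ : ∀ E z' A z → E * (z' + A * 2) + (z + 2) ≡ E * z' + z + (A * 2 * E + 2)
  regroup₃ = solve-∀

-- With b = 9E + 20 the square b² beats the linear error terms of ratio-bound.
ratio-slack : ∀ A E → A ≤ 3 → A * E * (3 * (9 * E + 20) + 4) + A * 2 * E + 2 < (9 * E + 20) * (9 * E + 20)
ratio-slack A E A≤3 = begin-strict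
  A * E * (3 * b + 4) + A * 2 * E + 2
    ≤⟨ +-monoˡ-≤ 2 (+-mono-≤ (*-monoˡ-≤ (3 * b + 4) (*-monoˡ-≤ E A≤3)) (*-monoˡ-≤ E (*-monoˡ-≤ 2 A≤3))) ⟩
  3 * E * (3 * b + 4) + 3 * 2 * E + 2                       <⟨ m<m+n _ z<s ⟩
  3 * E * (3 * b + 4) + 3 * 2 * E + 2 + suc (162 * E + 397) ≡⟨ expand E ⟩
  b * b                                                     ∎
  where
  open ≤-Reasoning
  b = 9 * E + 20
  expand : ∀ E → 3 * E * (3 * (9 * E + 20) + 4) + 3 * 2 * E + 2 + suc (162 * E + 397) ≡ (9 * E + 20) * (9 * E + 20)
  expand = solve-∀

liminf-from : ∀ kind A len → A ≤ 3 → (∀ b' p → Blowup kind A len b' p) → LiminfMSAtLeast zSSsr kind A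
liminf-from kind A len A≤3 blowup e = len b' , λ n len≤n →
  let w = blowup b' (n ∸ len b') in
  Blowup.T w , Blowup.T' w , trans (Blowup.length-T w) (m+[n∸m]≡n len≤n) , Blowup.one-edit w ,
  ratio-bound A (suc e) _ _ (square b') (3 * suc b' + 4) (Blowup.z≤ w) (Blowup.≤z' w) (Blowup.≤z w)
    (≤-trans (s≤s (≤-trans (s≤s z≤n) (m≤n+m 19 (9 * suc e)))) (m≤m*n (suc b') (suc b')))
    (subst (λ b → A * suc e * (3 * b + 4) + A * 2 * suc e + 2 < b * b) (+-suc (9 * suc e) 19) (ratio-slack A (suc e) A≤3))
  where
  b' = 9 * suc e + 19

excess-bound : ∀ A z z' b → A ≤ 3 → 2 ≤ b → z ≤ b * b + (3 * b + 4) → A * (b * b ∸ 2) ≤ z' → b * b ∸ 2 ≤ z →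
               (A * z ∸ z') * (A * z ∸ z') ≤ 26 * 26 * z
excess-bound A z z' b A≤3 2≤b z≤ ≤z' ≤z = ≤-trans (*-mono-≤ excess≤ excess≤) (+-cancelʳ-≤ 1352 _ _ (begin
  18 * b * (18 * b) + 1352   ≡⟨ cong (_+ 1352) (square-18 b) ⟩
  324 * K + 1352             ≤⟨ +-monoʳ-≤ (324 * K) (≤-trans (m≤m+n 1352 56) (*-monoʳ-≤ 352 4≤K)) ⟩
  324 * K + 352 * K          ≡⟨ sym (*-distribʳ-+ K 324 352) ⟩
  676 * K                    ≤⟨ *-monoʳ-≤ 676 (≤∸2⇒≤+2 K z 2≤K ≤z) ⟩
  676 * (z + 2)              ≡⟨ *-distribˡ-+ 676 z 2 ⟩
  26 * 26 * z + 1352         ∎))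
  where
  open ≤-Reasoning
  K = b * b
  4≤K : 4 ≤ K
  4≤K = *-mono-≤ 2≤b 2≤b
  2≤K : 2 ≤ K
  2≤K = ≤-trans (s≤s (s≤s z≤n)) 4≤K
  square-18 : ∀ b → 18 * b * (18 * b) ≡ 324 * (b * b)
  square-18 = solve-∀
  excess≤ : A * z ∸ z' ≤ 18 * b
  excess≤ = begin
    A * z ∸ z'                    ≤⟨ m≤n+o⇒m∸n≤o (A * z) z' (begin
      A * z                         ≤⟨ *-monoʳ-≤ A z≤ ⟩
      A * (K + (3 * b + 4))         ≡⟨ *-distribˡ-+ A K _ ⟩
      A * K + A * (3 * b + 4)       ≤⟨ +-monoˡ-≤ _ (*∸2⇒*≤ A K z' 2≤K ≤z') ⟩
      z' + A * 2 + A * (3 * b + 4)  ≡⟨ +-assoc z' _ _ ⟩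
      z' + (A * 2 + A * (3 * b + 4)) ∎) ⟩
    A * 2 + A * (3 * b + 4)       ≤⟨ +-mono-≤ (*-monoˡ-≤ 2 A≤3) (*-monoˡ-≤ (3 * b + 4) A≤3) ⟩
    3 * 2 + 3 * (3 * b + 4)       ≡⟨ linear b ⟩
    9 * b + 9 * 2                 ≤⟨ +-monoʳ-≤ (9 * b) (*-monoʳ-≤ 9 2≤b) ⟩
    9 * b + 9 * b                 ≡⟨ sym (*-distribʳ-+ b 9 9) ⟩
    18 * b                        ∎
    where
    linear : ∀ b → 3 * 2 + 3 * (3 * b + 4) ≡ 9 * b + 9 * 2
    linear = solve-∀

linear-from : ∀ kind a len → suc a ≤ 3 → (∀ b' p → Blowup kind (suc a) len b' p) → ASAtLeastLinear zSSsr kind a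
linear-from kind a len A≤3 blowup = 26 , λ m →
  let w = blowup (suc m) 0 in
  Blowup.T w , Blowup.T' w , ≤-trans (m≤square∸2 m) (Blowup.≤z w) , Blowup.one-edit w ,
  excess-bound (suc a) _ _ (2 + m) A≤3 (s≤s (s≤s z≤n)) (Blowup.z≤ w) (Blowup.≤z' w) (Blowup.≤z w)
  where
  m≤square∸2 : ∀ m → m ≤ square (suc m) ∸ 2
  m≤square∸2 m = subst (_≤ square (suc m) ∸ 2) (m+n∸n≡m m 2)
    (∸-monoˡ-≤ 2 (≤-trans (≤-reflexive (+-comm m 2)) (m≤m*n (2 + m) (2 + m))))

bracket : ∀ (f : ℕ → ℕ) → (∀ c → c ≤ f c) → ∀ c {n} → f c ≤ n → ∃ λ c' → c ≤ c' × f c' ≤ n × n < f (suc c')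
bracket f unbounded c {n} fc≤n = search n c ≤-refl fc≤n (m≤n+m n c)
  where
  search : ∀ fuel c' → c ≤ c' → f c' ≤ n → n ≤ c' + fuel → ∃ λ c'' → c ≤ c'' × f c'' ≤ n × n < f (suc c'')
  search fuel c' c≤c' fc'≤n n≤ with n <? f (suc c')
  ... | yes n< = c' , c≤c' , fc'≤n , n<
  search zero     c' c≤c' fc'≤n n≤ | no n≮ =
    ⊥-elim (<⇒≱ (≤-trans (unbounded (suc c')) (≮⇒≥ n≮)) (≤-trans n≤ (≤-reflexive (+-identityʳ c'))))
  search (suc fuel) c' c≤c' fc'≤n n≤ | no n≮ =
    search fuel (suc c') (m≤n⇒m≤1+n c≤c') (≮⇒≥ n≮) (subst (n ≤_) (+-suc c' fuel) n≤)

-- For b ≥ 10 the gain z' − z ≥ 2(b² − 2) − (b² + 3b + 4) is at least a quarter of (b + 1)² + 2.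
growth-bound : ∀ A z z' t → 2 ≤ A → z ≤ square (9 + t) + (3 * (10 + t) + 4) → A * (square (9 + t) ∸ 2) ≤ z' →
               square (10 + t) + 2 ≤ 4 * (z' ∸ z)
growth-bound A z z' t 2≤A z≤ ≤z' = subst (_≤ 4 * (z' ∸ z)) (m+n∸n≡m _ (4 * z))
  (≤-trans (∸-monoˡ-≤ (4 * z) (begin
    square (10 + t) + 2 + 4 * z
      ≤⟨ +-monoʳ-≤ (square (10 + t) + 2) (*-monoʳ-≤ 4 z≤) ⟩
    square (10 + t) + 2 + 4 * (square (9 + t) + (3 * (10 + t) + 4))
      ≤⟨ ≤-trans (m≤m+n _ (3 * (t * t) + 46 * t + 125)) (≤-reflexive (expand t)) ⟩
    8 * (t * t + 20 * t + 98)
      ≡⟨ cong (8 *_) (sym square∸2≡) ⟩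
    8 * (square (9 + t) ∸ 2)
      ≡⟨ *-assoc 4 2 (square (9 + t) ∸ 2) ⟩
    4 * (2 * (square (9 + t) ∸ 2))
      ≤⟨ *-monoʳ-≤ 4 (≤-trans (*-monoˡ-≤ _ 2≤A) ≤z') ⟩
    4 * z'   ∎))
  (≤-reflexive (sym (*-distribˡ-∸ 4 z' z))))
  where
  open ≤-Reasoning
  square∸2≡ : square (9 + t) ∸ 2 ≡ t * t + 20 * t + 98
  square∸2≡ = trans (cong (_∸ 2) (square≡ t)) (m+n∸n≡m _ 2)
    where
    square≡ : ∀ t → suc (9 + t) * suc (9 + t) ≡ (t * t + 20 * t + 98) + 2
    square≡ = solve-∀
  expand : ∀ t → suc (10 + t) * suc (10 + t) + 2 + 4 * (suc (9 + t) * suc (9 + t) + (3 * (10 + t) + 4))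
                 + (3 * (t * t) + 46 * t + 125) ≡ 8 * (t * t + 20 * t + 98)
  expand = solve-∀

sqrt-from : ∀ kind A len → 2 ≤ A → (∀ b' → b' ≤ len b') → (∀ b' → len b' ≤ (square b' + 2) * (square b' + 2)) →
            (∀ b' p → Blowup kind A len b' p) → ASOmegaSqrt zSSsr kind
sqrt-from kind A len 2≤A unbounded len≤ blowup = 3 , len 9 , λ n len≤n → witness n (bracket len unbounded 9 len≤n)
  where
  witness : ∀ n → (∃ λ c → 9 ≤ c × len c ≤ n × n < len (suc c)) → ∃[ T ] ∃[ T' ] (length T ≡ n × OneEdit kind T T' ×
            n ≤ (4 * (zSSsr T' ∸ zSSsr T)) * (4 * (zSSsr T' ∸ zSSsr T)))
  witness n (c , 9≤c , lenc≤n , n<) with m≤n⇒∃[o]m+o≡n 9≤c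
  ... | t , refl =
    let w = blowup (9 + t) (n ∸ len (9 + t))
        gain = growth-bound A _ _ t 2≤A (Blowup.z≤ w) (Blowup.≤z' w) in
    Blowup.T w , Blowup.T' w , trans (Blowup.length-T w) (m+[n∸m]≡n lenc≤n) , Blowup.one-edit w ,
    ≤-trans (<⇒≤ n<) (≤-trans (len≤ (10 + t)) (*-mono-≤ gain gain))

text-length-unbounded : ∀ c b' → b' ≤ text-length c b'
text-length-unbounded c b' =
  ≤-trans (n≤1+n b') (≤-trans (m≤m*n (suc b') (suc b')) (≤-trans (m≤m+n _ _) (m≤m+n _ _)))

text-length≤ : ∀ c → c ≤ 1 → ∀ b' → text-length c b' ≤ (square b' + 2) * (square b' + 2)
text-length≤ zero    _              b' = ≤-trans (m≤m+n _ (2 * square b' + 4)) (≤-reflexive (expand (square b')))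
  where
  expand : ∀ K → (K + (0 + K)) + (K * K + K * 0) + (2 * K + 4) ≡ (K + 2) * (K + 2)
  expand = solve-∀
text-length≤ (suc zero) _          b' = ≤-trans (m≤m+n _ (square b' + 3)) (≤-reflexive (expand (square b')))
  where
  expand : ∀ K → (K + (1 + K)) + (K * K + K * 1) + (K + 3) ≡ (K + 2) * (K + 2)
  expand = solve-∀
text-length≤ (suc (suc c)) (s≤s ()) b'

theorem20 :
    (LiminfMSAtLeast zSSsr sub 3 × ASAtLeastLinear zSSsr sub 2 × ASOmegaSqrt zSSsr sub)
    × (LiminfMSAtLeast zSSsr ins 2 × ASAtLeastLinear zSSsr ins 1 × ASOmegaSqrt zSSsr ins)
    × (LiminfMSAtLeast zSSsr del 3 × ASAtLeastLinear zSSsr del 2 × ASOmegaSqrt zSSsr del)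
theorem20 =
  ( liminf-from sub 3 (text-length 1) ≤-refl substitution-blowup
  , linear-from sub 2 (text-length 1) ≤-refl substitution-blowup
  , sqrt-from sub 3 (text-length 1) 2≤3 (text-length-unbounded 1) (text-length≤ 1 ≤-refl) substitution-blowup )
  , ( liminf-from ins 2 (text-length 0) 2≤3 insertion-blowup
  , linear-from ins 1 (text-length 0) 2≤3 insertion-blowup
  , sqrt-from ins 2 (text-length 0) ≤-refl (text-length-unbounded 0) (text-length≤ 0 z≤n) insertion-blowup )
  , ( liminf-from del 3 (text-length 1) ≤-refl deletion-blowup
  , linear-from del 2 (text-length 1) ≤-refl deletion-blowup
  , sqrt-from del 3 (text-length 1) 2≤3 (text-length-unbounded 1) (text-length≤ 1 ≤-refl) deletion-blowup )
  where
  2≤3 : 2 ≤ 3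
  2≤3 = s≤s (s≤s z≤n)
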